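{- Let $r\geq 2$ be an integer. If $G$ is a $(2r-2,2r)$-biregular graph, then $G$ is cyclically interval colorable and $w_c(G)=2r$.
   Context: All graphs are finite and undirected; multiple edges are allowed, loops are not. An $(a,b)$-biregular graph is a bipartite graph with a bipartition in which all vertices of one part have degree $a$ and all vertices of the other part have degree $b$. A proper $t$-edge coloring of $G$ is a map $\alpha:E(G)\to\{1,\dots,t\}$ with $\alpha(e)\neq\alpha(e')$ for adjacent edges $e,e'$; $S(v,\alpha)$ is the set of colors on edges incident to $v$. A proper $t$-edge coloring $\alpha$ is a cyclic interval $t$-coloring if for every vertex $v$, either $S(v,\alpha)$ or $\{1,\dots,t\}\setminus S(v,\alpha)$ is a set of consecutive integers. A graph is cyclically interval colorable if it has a cyclic interval $t$-coloring for some positive integer $t$, and then $w_c(G)$ denotes the least such $t$. -}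

module Defs where

open import Data.Nat using (ℕ; zero; suc; _+_; _*_; _∸_; _≤_; _≥_; NonZero)
open import Data.Fin using (Fin)
open import Data.Fin.Properties using (_≟_)
open import Data.Bool using (Bool; true; false)
open import Data.List using (List; map; allFin)
open import Data.Nat.ListAction using (sum)
open import Data.Product using (Σ; _×_; _,_; proj₁; proj₂; ∃-syntax)
open import Data.Sum using (_⊎_)
open import Relation.Nullary using (¬_; Dec; yes; no)
open import Relation.Binary.PropositionalEquality using (_≡_; _≢_)

record Graph : Set where
  field
    n     : ℕ
    m     : ℕ
    ends  : Fin m → Fin n × Fin n
    loopless : (e : Fin m) → proj₁ (ends e) ≢ proj₂ (ends e)
open Graph public

Incident : (G : Graph) → Fin (m G) → Fin (n G) → Set
Incident G e v = proj₁ (ends G e) ≡ v ⊎ proj₂ (ends G e) ≡ v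

private
  ind : {k : ℕ} → Fin k → Fin k → ℕ
  ind a b with a ≟ b
  ... | yes _ = 1
  ... | no  _ = 0

-- degree of v: number of edges incident to v (no loops, so each edge
-- contributes via exactly one endpoint)
degree : (G : Graph) → Fin (n G) → ℕ
degree G v = sum (map (λ e → ind (proj₁ (ends G e)) v + ind (proj₂ (ends G e)) v) (allFin (m G)))

Biregular : ℕ → ℕ → Graph → Set
Biregular a b G =
  Σ (Fin (n G) → Bool) λ side →
    ((e : Fin (m G)) → side (proj₁ (ends G e)) ≢ side (proj₂ (ends G e)))
    × ((v : Fin (n G)) → side v ≡ false → degree G v ≡ a)
    × ((v : Fin (n G)) → side v ≡ true  → degree G v ≡ b)

IsProperColoring : (G : Graph) → ℕ → (Fin (m G) → ℕ) → Set
IsProperColoring G t α =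
  ((e : Fin (m G)) → 1 ≤ α e × α e ≤ t)
  × ((e e' : Fin (m G)) (v : Fin (n G)) → e ≢ e' →
       Incident G e v → Incident G e' v → α e ≢ α e')

InS : (G : Graph) → (Fin (m G) → ℕ) → Fin (n G) → ℕ → Set
InS G α v c = ∃[ e ] (Incident G e v × α e ≡ c)

InCoS : (G : Graph) → ℕ → (Fin (m G) → ℕ) → Fin (n G) → ℕ → Set
InCoS G t α v c = (1 ≤ c × c ≤ t) × ¬ InS G α v c

Consecutive : (ℕ → Set) → Set
Consecutive P = (x y z : ℕ) → P x → P z → x ≤ y → y ≤ z → P y

IsCyclicIntervalColoring : (G : Graph) → ℕ → (Fin (m G) → ℕ) → Set
IsCyclicIntervalColoring G t α =
  IsProperColoring G t α
  × ((v : Fin (n G)) → Consecutive (InS G α v) ⊎ Consecutive (InCoS G t α v))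

HasCyclicIntervalColoring : Graph → ℕ → Set
HasCyclicIntervalColoring G t = Σ (Fin (m G) → ℕ) (IsCyclicIntervalColoring G t)

CyclicallyIntervalColorable : Graph → Set
CyclicallyIntervalColorable G = Σ ℕ λ t → 1 ≤ t × HasCyclicIntervalColoring G t

WcIs : Graph → ℕ → Set
WcIs G w = (1 ≤ w × HasCyclicIntervalColoring G w)
         × ((t : ℕ) → 1 ≤ t → HasCyclicIntervalColoring G t → w ≤ t)

-- Let X (side false) and Y (side true) be the sides of G, of degrees 2r − 2 and 2r.  Pairing
-- up the edges at every vertex and 2-edge-colouring the bipartite graph of these pairs (Kőnig)
-- gives an orientation in which every vertex has in- and out-degree half its degree.  Split
-- every vertex into an out-copy and an in-copy and join the two copies of each X-vertex by a
-- dummy edge: the result is bipartite of maximum degree r, so by Kőnig it has a proper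
-- r-edge-colouring c.  Colour e by 2c(e) + 1 or 2c(e) + 2 according as its tail lies in X or
-- in Y.  A Y-vertex then sees every colour 1, …, 2r, while an X-vertex misses exactly 2i + 1
-- and 2i + 2, where i is the colour of its dummy edge.  As a Y-vertex has 2r edges, fewer
-- colours are impossible.

module Submission where

open import Defs
open import Data.Bool using (Bool; true; false; not; _xor_; if_then_else_)
import Data.Bool.Properties as Bool
open import Data.Fin as Fin using (Fin; zero; suc; toℕ; fromℕ<; _↑ˡ_; _↑ʳ_; punchOut)
open import Data.Fin.Properties as Fin using (_≟_; injective⇒≤; any?; all?; ¬∀⟶∃¬; 2↔Bool)
import Data.Fin.Permutation.Components as Perm
open import Data.List using (tabulate; allFin)
import Data.List as List
import Data.List.Properties as List
open import Data.Maybe using (Maybe; just; nothing; _>>=_)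
import Data.Maybe.Properties as Maybe
open import Data.Nat as ℕ using (ℕ; zero; suc; _+_; _*_; _∸_; _≤_; _<_; z≤n; s≤s; NonZero)
open import Data.Nat.DivMod using (_/_; _%_; m%n<n; m≡m%n+[m/n]*n; m<n*o⇒m/o<n)
open import Data.Nat.ListAction using (sum)
open import Data.Nat.Properties as ℕ using (≤-refl; ≤-trans; <⇒≱; n≤1+n)
open import Data.Product using (_×_; _,_; proj₁; proj₂; ∃)
import Data.Product.Properties as Product
open import Data.Sum using (_⊎_; inj₁; inj₂; [_,_]; [_,_]′)
import Data.Sum.Properties as Sum
open import Data.Vec.Functional using (_∷_)
open import Function using (_∘_; _⇔_; Equivalence; mk⇔; Inverse)
open import Function.Definitions using (Injective)
open import Level using (0ℓ)
open import Relation.Binary.Definitions using (DecidableEquality; tri<; tri≈; tri>)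
open import Relation.Binary.PropositionalEquality
  using (_≡_; _≢_; refl; sym; trans; cong; cong₂; subst; module ≡-Reasoning)
open import Relation.Nullary using (¬_; Dec; yes; no; contradiction)
open import Relation.Nullary.Decidable using (_×-dec_; _⊎-dec_; dec-true; dec-false)
open import Relation.Unary using (Pred; Decidable)

-- Counting the elements of decidable subsets of Fin m

injective⇒surjective : ∀ {k l} {f : Fin k → Fin l} → Injective _≡_ _≡_ f → l ≤ k →
                       ∀ j → ∃ λ i → f i ≡ j
injective⇒surjective {k} {suc l} {f} f-inj l≤k j with any? (λ i → f i ≟ j)
... | yes hit = hit
... | no miss = contradiction (injective⇒≤ g-inj) (<⇒≱ l≤k)
  where
  g : Fin k → Fin l
  g i = punchOut {i = j} {j = f i} (λ fi≡j → miss (i , sym fi≡j))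
  g-inj : Injective _≡_ _≡_ g
  g-inj {i} {i′} = f-inj ∘ Fin.punchOut-injective (λ fi≡j → miss (i , sym fi≡j))
                                                   (λ fi≡j → miss (i′ , sym fi≡j))

count : ∀ {m} {P : Pred (Fin m) 0ℓ} → Decidable P → ℕ
count {zero}  P? = 0
count {suc m} P? with P? zero
... | yes _ = suc (count (P? ∘ suc))
... | no  _ = count (P? ∘ suc)

count-mono : ∀ {m} {P Q : Pred (Fin m) 0ℓ} (P? : Decidable P) (Q? : Decidable Q) →
             (∀ {e} → P e → Q e) → count P? ≤ count Q?
count-mono {zero}  P? Q? P⊆Q = z≤n
count-mono {suc m} P? Q? P⊆Q with P? zero | Q? zero
... | yes _ | yes _ = s≤s (count-mono (P? ∘ suc) (Q? ∘ suc) P⊆Q)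
... | yes p | no ¬q = contradiction (P⊆Q p) ¬q
... | no _  | yes _ = ≤-trans (count-mono (P? ∘ suc) (Q? ∘ suc) P⊆Q) (n≤1+n _)
... | no _  | no _  = count-mono (P? ∘ suc) (Q? ∘ suc) P⊆Q

count-< : ∀ {m} {P Q : Pred (Fin m) 0ℓ} (P? : Decidable P) (Q? : Decidable Q) →
          (∀ {e} → P e → Q e) → ∀ {e} → ¬ P e → Q e → count P? < count Q?
count-< {suc m} P? Q? P⊆Q {zero} ¬p q with P? zero | Q? zero
... | yes p | _     = contradiction p ¬p
... | no _  | no ¬q = contradiction q ¬q
... | no _  | yes _ = s≤s (count-mono (P? ∘ suc) (Q? ∘ suc) P⊆Q)
count-< {suc m} P? Q? P⊆Q {suc e} ¬p q with P? zero | Q? zero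
... | yes p | yes _ = s≤s (count-< (P? ∘ suc) (Q? ∘ suc) P⊆Q ¬p q)
... | yes p | no ¬q = contradiction (P⊆Q p) ¬q
... | no _  | yes _ = ≤-trans (count-< (P? ∘ suc) (Q? ∘ suc) P⊆Q ¬p q) (n≤1+n _)
... | no _  | no _  = count-< (P? ∘ suc) (Q? ∘ suc) P⊆Q ¬p q

count-⊎ : ∀ {m} {P Q R : Pred (Fin m) 0ℓ} (P? : Decidable P) (Q? : Decidable Q) (R? : Decidable R) →
          (∀ {e} → P e ⇔ (Q e ⊎ R e)) → (∀ {e} → Q e → ¬ R e) →
          count P? ≡ count Q? + count R?
count-⊎ {zero}  P? Q? R? P⇔Q⊎R Q∩R=∅ = refl
count-⊎ {suc m} P? Q? R? P⇔Q⊎R Q∩R=∅ with P? zero | Q? zero | R? zero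
... | _     | yes q | yes r = contradiction r (Q∩R=∅ q)
... | yes _ | yes _ | no _  = cong suc (count-⊎ (P? ∘ suc) (Q? ∘ suc) (R? ∘ suc) P⇔Q⊎R Q∩R=∅)
... | yes _ | no _  | yes _ = trans (cong suc (count-⊎ (P? ∘ suc) (Q? ∘ suc) (R? ∘ suc) P⇔Q⊎R Q∩R=∅))
                                    (sym (ℕ.+-suc _ _))
... | yes p | no ¬q | no ¬r = contradiction (Equivalence.to P⇔Q⊎R p) [ ¬q , ¬r ]
... | no ¬p | yes q | _     = contradiction (Equivalence.from P⇔Q⊎R (inj₁ q)) ¬p
... | no ¬p | _     | yes r = contradiction (Equivalence.from P⇔Q⊎R (inj₂ r)) ¬p
... | no _  | no _  | no _  = count-⊎ (P? ∘ suc) (Q? ∘ suc) (R? ∘ suc) P⇔Q⊎R Q∩R=∅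

count-↑ : ∀ {M N} {P : Pred (Fin (M + N)) 0ℓ} (P? : Decidable P) →
          count P? ≡ count (P? ∘ (_↑ˡ N)) + count (P? ∘ (M ↑ʳ_))
count-↑ {zero}      P? = refl
count-↑ {suc M} {N} P? with P? zero
... | yes _ = cong suc (count-↑ {M} {N} (P? ∘ suc))
... | no  _ = count-↑ {M} {N} (P? ∘ suc)

count-∘suc : ∀ {m} {P : Pred (Fin (suc m)) 0ℓ} (P? : Decidable P) → count (P? ∘ suc) ≤ count P?
count-∘suc P? with P? zero
... | yes _ = n≤1+n _
... | no  _ = ≤-refl

count-≡ : ∀ {m} {P Q : Pred (Fin m) 0ℓ} (P? : Decidable P) (Q? : Decidable Q) →
          (∀ {e} → P e ⇔ Q e) → count P? ≡ count Q?
count-≡ P? Q? P⇔Q = ℕ.≤-antisym (count-mono P? Q? (Equivalence.to P⇔Q))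
                                (count-mono Q? P? (Equivalence.from P⇔Q))

rank : ∀ {m} {P : Pred (Fin m) 0ℓ} → Decidable P → Fin m → ℕ
rank P? e = count (λ z → P? z ×-dec z Fin.<? e)

module _ {m} {P : Pred (Fin m) 0ℓ} (P? : Decidable P) where

  rank-< : ∀ {e} → P e → rank P? e < count P?
  rank-< {e} p = count-< (λ z → P? z ×-dec z Fin.<? e) P? proj₁ (λ (_ , e<e) → ℕ.<-irrefl refl e<e) p

  rank-strict : ∀ {e e′} → P e → e Fin.< e′ → rank P? e < rank P? e′
  rank-strict {e} {e′} p e<e′ =
    count-< (λ z → P? z ×-dec z Fin.<? e) (λ z → P? z ×-dec z Fin.<? e′)
            (λ (q , z<e) → q , ℕ.<-trans z<e e<e′) (λ (_ , e<e) → ℕ.<-irrefl refl e<e) (p , e<e′)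

  rank-injective : ∀ {e e′} → P e → P e′ → rank P? e ≡ rank P? e′ → e ≡ e′
  rank-injective {e} {e′} p p′ eq with Fin.<-cmp e e′
  ... | tri< e<e′ _ _ = contradiction eq (ℕ.<⇒≢ (rank-strict p e<e′))
  ... | tri≈ _ e≡e′ _ = e≡e′
  ... | tri> _ _ e>e′ = contradiction (sym eq) (ℕ.<⇒≢ (rank-strict p′ e>e′))

enumerate : ∀ {m} {P : Pred (Fin m) 0ℓ} (P? : Decidable P) → Fin (count P?) → Fin m
enumerate {suc m} P? i with P? zero
enumerate {suc m} P? zero    | yes _ = zero
enumerate {suc m} P? (suc i) | yes _ = suc (enumerate (P? ∘ suc) i)
enumerate {suc m} P? i       | no  _ = suc (enumerate (P? ∘ suc) i)

enumerate-∈ : ∀ {m} {P : Pred (Fin m) 0ℓ} (P? : Decidable P) i → P (enumerate P? i)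
enumerate-∈ {suc m} P? i with P? zero
enumerate-∈ {suc m} P? zero    | yes p = p
enumerate-∈ {suc m} P? (suc i) | yes _ = enumerate-∈ (P? ∘ suc) i
enumerate-∈ {suc m} P? i       | no  _ = enumerate-∈ (P? ∘ suc) i

enumerate-injective : ∀ {m} {P : Pred (Fin m) 0ℓ} (P? : Decidable P) →
                      Injective _≡_ _≡_ (enumerate P?)
enumerate-injective {suc m} P? {i} {j} eq with P? zero
enumerate-injective {suc m} P? {zero}  {zero}  eq | yes _ = refl
enumerate-injective {suc m} P? {suc i} {suc j} eq | yes _ =
  cong suc (enumerate-injective (P? ∘ suc) (Fin.suc-injective eq))
enumerate-injective {suc m} P? {i}     {j}     eq | no  _ =
  enumerate-injective (P? ∘ suc) (Fin.suc-injective eq)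

InjectiveOn : ∀ {A B : Set} → Pred A 0ℓ → (A → B) → Set
InjectiveOn P φ = ∀ {x y} → P x → P y → φ x ≡ φ y → x ≡ y

module _ {m} {P : Pred (Fin m) 0ℓ} (P? : Decidable P) where

  count-≥ : ∀ {k} (g : Fin k → Fin m) → Injective _≡_ _≡_ g → (∀ i → P (g i)) →
            k ≤ count P?
  count-≥ g g-inj g∈P = injective⇒≤ {f = λ i → fromℕ< (rank-< P? (g∈P i))} λ eq →
    g-inj (rank-injective P? (g∈P _) (g∈P _) (Fin.fromℕ<-injective _ _ _ _ eq))

  module _ {t} (φ : Fin m → ℕ) (φ<t : ∀ {e} → P e → φ e < t) (φ-inj : InjectiveOn P φ) where

    private
      ψ : Fin (count P?) → Fin t
      ψ i = fromℕ< (φ<t (enumerate-∈ P? i))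

      ψ-injective : Injective _≡_ _≡_ ψ
      ψ-injective eq = enumerate-injective P?
        (φ-inj (enumerate-∈ P? _) (enumerate-∈ P? _) (Fin.fromℕ<-injective _ _ _ _ eq))

    count-≤ : count P? ≤ t
    count-≤ = injective⇒≤ ψ-injective

    count-covers : t ≤ count P? → ∀ {j} → j < t → ∃ λ e → P e × φ e ≡ j
    count-covers t≤count {j} j<t with injective⇒surjective ψ-injective t≤count (fromℕ< j<t)
    ... | i , ψi≡j = enumerate P? i , enumerate-∈ P? i ,
      Fin.fromℕ<-injective _ _ _ _ ψi≡j

-- Kőnig: a bipartite multigraph of maximum degree Δ has a proper Δ-edge-colouring

degreeAt : ∀ {A : Set} {m} → DecidableEquality A → (Fin m → A) → A → ℕ
degreeAt _≟ᴬ_ end x = count (λ e → end e ≟ᴬ x)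

ProperAt : ∀ {A : Set} {m Δ} → (Fin m → A) → (Fin m → Fin Δ) → Set
ProperAt end c = ∀ {e e′} → end e ≡ end e′ → c e ≡ c e′ → e ≡ e′

Missing : ∀ {A : Set} {m Δ} → (Fin m → A) → (Fin m → Fin Δ) → A → Fin Δ → Set
Missing end c x a = ∀ e → end e ≡ x → c e ≢ a

missing-colour : ∀ {A : Set} (_≟ᴬ_ : DecidableEquality A) {m Δ} (end : Fin (suc m) → A) →
                 degreeAt _≟ᴬ_ end (end zero) ≤ Δ → (c : Fin m → Fin Δ) →
                 ∃ λ a → Missing (end ∘ suc) c (end zero) a
missing-colour _≟ᴬ_ {m} {Δ} end deg≤Δ c = by-cases (all? used?)
  where
  Used : Fin Δ → Set
  Used a = ∃ λ e → end (suc e) ≡ end zero × c e ≡ a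

  used? : Decidable Used
  used? a = any? (λ e → (end (suc e) ≟ᴬ end zero) ×-dec (c e ≟ a))

  by-cases : Dec (∀ a → Used a) → ∃ λ a → Missing (end ∘ suc) c (end zero) a
  by-cases (no ¬all) =
    let (a , unused) = ¬∀⟶∃¬ _ _ used? ¬all in a , λ e at ce≡a → unused (e , at , ce≡a)
  by-cases (yes used) =
    contradiction deg≤Δ (<⇒≱ (count-≥ (λ e → end e ≟ᴬ end zero) k k-injective k-at))
    where
    k : Fin (suc Δ) → Fin (suc m)
    k zero    = zero
    k (suc a) = suc (proj₁ (used a))

    k-at : ∀ i → end (k i) ≡ end zero
    k-at zero    = refl
    k-at (suc a) = proj₁ (proj₂ (used a))

    k-injective : Injective _≡_ _≡_ k
    k-injective {zero}  {zero}  _  = refl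
    k-injective {suc a} {suc b} eq = cong suc (begin
      a                       ≡⟨ proj₂ (proj₂ (used a)) ⟨
      c (proj₁ (used a))      ≡⟨ cong c (Fin.suc-injective eq) ⟩
      c (proj₁ (used b))      ≡⟨ proj₂ (proj₂ (used b)) ⟩
      b                       ∎)
      where open ≡-Reasoning

module KempeChain {V W : Set} (_≟ⱽ_ : DecidableEquality V) (_≟ᵂ_ : DecidableEquality W)
  {m Δ} (left : Fin m → V) (right : Fin m → W) (c : Fin m → Fin Δ)
  (proper-left : ProperAt left c) (proper-right : ProperAt right c)
  {u : V} {w : W} {a b : Fin Δ} (a-missing : Missing left c u a) (b-missing : Missing right c w b)
  (a≢b : a ≢ b) where

  Vertex : Set
  Vertex = V ⊎ W

  _≟ᵛ_ : DecidableEquality Vertex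
  _≟ᵛ_ = Sum.≡-dec _≟ⱽ_ _≟ᵂ_

  Alternating : Pred (Fin m) 0ℓ
  Alternating e = c e ≡ a ⊎ c e ≡ b

  alternating? : Decidable Alternating
  alternating? e = (c e ≟ a) ⊎-dec (c e ≟ b)

  -- a-edges are traversed from right to left and b-edges from left to right.  The walk
  -- starting at w then never returns to w (no b-edge there) and never reaches u (no a-edge
  -- there), so swapping a and b along it frees a at w while keeping it free at u.
  tail head : Fin m → Vertex
  tail e with c e ≟ a
  ... | yes _ = inj₂ (right e)
  ... | no  _ = inj₁ (left e)
  head e with c e ≟ a
  ... | yes _ = inj₁ (left e)
  ... | no  _ = inj₂ (right e)

  tail-a : ∀ {e} → c e ≡ a → tail e ≡ inj₂ (right e)
  tail-a {e} ce≡a with c e ≟ a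
  ... | yes _    = refl
  ... | no ce≢a = contradiction ce≡a ce≢a

  head-a : ∀ {e} → c e ≡ a → head e ≡ inj₁ (left e)
  head-a {e} ce≡a with c e ≟ a
  ... | yes _    = refl
  ... | no ce≢a = contradiction ce≡a ce≢a

  tail-b : ∀ {e} → c e ≡ b → tail e ≡ inj₁ (left e)
  tail-b {e} ce≡b with c e ≟ a
  ... | yes ce≡a = contradiction (trans (sym ce≡a) ce≡b) a≢b
  ... | no  _    = refl

  head-b : ∀ {e} → c e ≡ b → head e ≡ inj₂ (right e)
  head-b {e} ce≡b with c e ≟ a
  ... | yes ce≡a = contradiction (trans (sym ce≡a) ce≡b) a≢b
  ... | no  _    = refl

  head-injective : ∀ {e e′} → Alternating e → Alternating e′ → head e ≡ head e′ → e ≡ e′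
  head-injective (inj₁ ea) (inj₁ ea′) eq =
    proper-left (Sum.inj₁-injective (trans (sym (head-a ea)) (trans eq (head-a ea′))))
                (trans ea (sym ea′))
  head-injective (inj₂ eb) (inj₂ eb′) eq =
    proper-right (Sum.inj₂-injective (trans (sym (head-b eb)) (trans eq (head-b eb′))))
                 (trans eb (sym eb′))
  head-injective (inj₁ ea) (inj₂ eb′) eq with () ← trans (sym (head-a ea)) (trans eq (head-b eb′))
  head-injective (inj₂ eb) (inj₁ ea′) eq with () ← trans (sym (head-b eb)) (trans eq (head-a ea′))

  tail-injective : ∀ {e e′} → Alternating e → Alternating e′ → tail e ≡ tail e′ → e ≡ e′
  tail-injective (inj₁ ea) (inj₁ ea′) eq =
    proper-right (Sum.inj₂-injective (trans (sym (tail-a ea)) (trans eq (tail-a ea′))))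
                 (trans ea (sym ea′))
  tail-injective (inj₂ eb) (inj₂ eb′) eq =
    proper-left (Sum.inj₁-injective (trans (sym (tail-b eb)) (trans eq (tail-b eb′))))
                (trans eb (sym eb′))
  tail-injective (inj₁ ea) (inj₂ eb′) eq with () ← trans (sym (tail-a ea)) (trans eq (tail-b eb′))
  tail-injective (inj₂ eb) (inj₁ ea′) eq with () ← trans (sym (tail-b eb)) (trans eq (tail-a ea′))

  head-≢-u : ∀ {e} → Alternating e → head e ≢ inj₁ u
  head-≢-u (inj₁ ea) eq = a-missing _ (Sum.inj₁-injective (trans (sym (head-a ea)) eq)) ea
  head-≢-u (inj₂ eb) eq with () ← trans (sym (head-b eb)) eq

  head-≢-w : ∀ {e} → Alternating e → head e ≢ inj₂ w
  head-≢-w (inj₁ ea) eq with () ← trans (sym (head-a ea)) eq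
  head-≢-w (inj₂ eb) eq = b-missing _ (Sum.inj₂-injective (trans (sym (head-b eb)) eq)) eb

  next : Vertex → Maybe (Fin m)
  next x with any? (λ e → alternating? e ×-dec (tail e ≟ᵛ x))
  ... | yes (e , _) = just e
  ... | no  _       = nothing

  next-sound : ∀ {x e} → next x ≡ just e → Alternating e × tail e ≡ x
  next-sound {x} eq with any? (λ e → alternating? e ×-dec (tail e ≟ᵛ x))
  next-sound refl | yes (_ , found) = found

  next-complete : ∀ {x e} → Alternating e → tail e ≡ x → next x ≡ just e
  next-complete {x} alt te≡x with any? (λ e → alternating? e ×-dec (tail e ≟ᵛ x))
  ... | yes (e′ , alt′ , te′≡x) = cong just (tail-injective alt′ alt (trans te′≡x (sym te≡x)))
  ... | no none = contradiction (_ , alt , te≡x) none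

  walk : ℕ → Maybe (Fin m)
  walk zero    = next (inj₂ w)
  walk (suc k) = walk k >>= next ∘ head

  walk-start : ∀ {e} → walk zero ≡ just e → tail e ≡ inj₂ w
  walk-start = proj₂ ∘ next-sound

  walk-step : ∀ {k e} → walk k ≡ just e → walk (suc k) ≡ next (head e)
  walk-step eq = cong (_>>= next ∘ head) eq

  walk-previous : ∀ {k e} → walk (suc k) ≡ just e → ∃ λ e′ → walk k ≡ just e′ × tail e ≡ head e′
  walk-previous {k} eq with walk k
  ... | just e′ = e′ , refl , proj₂ (next-sound eq)

  walk-alternating : ∀ {k e} → walk k ≡ just e → Alternating e
  walk-alternating {zero}  eq = proj₁ (next-sound eq)
  walk-alternating {suc k} eq with walk k
  ... | just _ = proj₁ (next-sound eq)

  walk-injective : ∀ {i j e} → walk i ≡ just e → walk j ≡ just e → i ≡ j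
  walk-injective {zero}  {zero}  _ _ = refl
  walk-injective {zero}  {suc j} p q =
    let (e′ , q′ , te≡he′) = walk-previous {j} q in
    contradiction (trans (sym te≡he′) (walk-start p)) (head-≢-w (walk-alternating {j} q′))
  walk-injective {suc i} {zero}  p q = sym (walk-injective q p)
  walk-injective {suc i} {suc j} p q =
    let (e₁ , p′ , te≡he₁) = walk-previous {i} p
        (e₂ , q′ , te≡he₂) = walk-previous {j} q
        e₁≡e₂ = head-injective (walk-alternating {i} p′) (walk-alternating {j} q′)
                  (trans (sym te≡he₁) te≡he₂)
    in cong suc (walk-injective p′ (subst (λ e → walk j ≡ just e) (sym e₁≡e₂) q′))

  walk-prefix : ∀ {k e i} → walk k ≡ just e → i ≤ k → ∃ λ e′ → walk i ≡ just e′
  walk-prefix {k} {e} eq i≤k with ℕ.m≤n⇒m<n∨m≡n i≤k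
  ... | inj₂ refl = e , eq
  walk-prefix {suc k} eq _ | inj₁ (s≤s i≤k) = walk-prefix (proj₁ (proj₂ (walk-previous {k} eq))) i≤k

  walk-length : ∀ {k e} → walk k ≡ just e → k < m
  walk-length {k} {e} eq with k ℕ.<? m
  ... | yes k<m = k<m
  ... | no k≮m = contradiction (injective⇒≤ g-injective) ℕ.1+n≰n
    where
    visited : ∀ (i : Fin (suc m)) → ∃ λ e′ → walk (toℕ i) ≡ just e′
    visited i = walk-prefix eq (ℕ.≤-trans (ℕ.s≤s⁻¹ (Fin.toℕ<n i)) (ℕ.≮⇒≥ k≮m))
    g : Fin (suc m) → Fin m
    g = proj₁ ∘ visited
    g-injective : Injective _≡_ _≡_ g
    g-injective {i} {j} gi≡gj = Fin.toℕ-injective (walk-injective {toℕ i} (proj₂ (visited i))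
      (subst (λ e → walk (toℕ j) ≡ just e) (sym gi≡gj) (proj₂ (visited j))))

  OnWalk : Pred (Fin m) 0ℓ
  OnWalk e = ∃ λ k → walk k ≡ just e

  onWalk? : Decidable OnWalk
  onWalk? e with any? (λ (i : Fin m) → Maybe.≡-dec _≟_ (walk (toℕ i)) (just e))
  ... | yes (i , eq) = yes (toℕ i , eq)
  ... | no never     = no λ (k , eq) → let k<m = walk-length {k} eq in
    never (fromℕ< k<m , trans (cong walk (Fin.toℕ-fromℕ< k<m)) eq)

  onWalk-alternating : ∀ {e} → OnWalk e → Alternating e
  onWalk-alternating (k , eq) = walk-alternating {k} eq

  onWalk-forward : ∀ {e e′} → OnWalk e → Alternating e′ → tail e′ ≡ head e → OnWalk e′
  onWalk-forward (k , eq) alt′ te′≡he = suc k , trans (walk-step {k} eq) (next-complete alt′ te′≡he)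

  onWalk-backward : ∀ {e e′} → OnWalk e → Alternating e′ → head e′ ≡ tail e → OnWalk e′
  onWalk-backward (zero , eq) alt′ he′≡te =
    contradiction (trans he′≡te (walk-start eq)) (head-≢-w alt′)
  onWalk-backward (suc k , eq) alt′ he′≡te =
    let (e₁ , eq₁ , te≡he₁) = walk-previous {k} eq in
    k , trans eq₁ (cong just (head-injective (walk-alternating {k} eq₁) alt′
                                             (trans (sym te≡he₁) (sym he′≡te))))

  onWalk-tail-≢-u : ∀ {e} → OnWalk e → tail e ≢ inj₁ u
  onWalk-tail-≢-u (zero , eq) te≡u with () ← trans (sym (walk-start eq)) te≡u
  onWalk-tail-≢-u (suc k , eq) te≡u =
    let (e₁ , eq₁ , te≡he₁) = walk-previous {k} eq in
    head-≢-u (walk-alternating {k} eq₁) (trans (sym te≡he₁) te≡u)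

  swap : Fin Δ → Fin Δ
  swap = Perm.transpose a b

  swap-injective : Injective _≡_ _≡_ swap
  swap-injective {x} {y} eq = begin
    x                           ≡⟨ Perm.transpose-inverse b a ⟨
    Perm.transpose b a (swap x) ≡⟨ cong (Perm.transpose b a) eq ⟩
    Perm.transpose b a (swap y) ≡⟨ Perm.transpose-inverse b a ⟩
    y                           ∎
    where open ≡-Reasoning

  swapped : ∀ {e x} → Alternating e → swap (c e) ≡ x → (c e ≡ a × x ≡ b) ⊎ (c e ≡ b × x ≡ a)
  swapped {e} (inj₁ ce≡a) eq rewrite ce≡a | dec-true (a ≟ a) refl = inj₁ (refl , sym eq)
  swapped {e} (inj₂ ce≡b) eq rewrite ce≡b | dec-false (b ≟ a) (a≢b ∘ sym) | dec-true (b ≟ b) refl =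
    inj₂ (refl , sym eq)

  c′ : Fin m → Fin Δ
  c′ e with onWalk? e
  ... | yes _ = swap (c e)
  ... | no  _ = c e

  mixed-left : ∀ {e e′} → OnWalk e → ¬ OnWalk e′ → left e ≡ left e′ → swap (c e) ≢ c e′
  mixed-left on off le≡le′ eq with swapped (onWalk-alternating on) eq
  ... | inj₁ (ce≡a , ce′≡b) = off (onWalk-forward on (inj₂ ce′≡b)
          (trans (tail-b ce′≡b) (trans (cong inj₁ (sym le≡le′)) (sym (head-a ce≡a)))))
  ... | inj₂ (ce≡b , ce′≡a) = off (onWalk-backward on (inj₁ ce′≡a)
          (trans (head-a ce′≡a) (trans (cong inj₁ (sym le≡le′)) (sym (tail-b ce≡b)))))

  mixed-right : ∀ {e e′} → OnWalk e → ¬ OnWalk e′ → right e ≡ right e′ → swap (c e) ≢ c e′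
  mixed-right on off re≡re′ eq with swapped (onWalk-alternating on) eq
  ... | inj₁ (ce≡a , ce′≡b) = off (onWalk-backward on (inj₂ ce′≡b)
          (trans (head-b ce′≡b) (trans (cong inj₂ (sym re≡re′)) (sym (tail-a ce≡a)))))
  ... | inj₂ (ce≡b , ce′≡a) = off (onWalk-forward on (inj₁ ce′≡a)
          (trans (tail-a ce′≡a) (trans (cong inj₂ (sym re≡re′)) (sym (head-b ce≡b)))))

  proper-left′ : ProperAt left c′
  proper-left′ {e} {e′} le≡le′ eq with onWalk? e | onWalk? e′
  ... | yes _   | yes _   = proper-left le≡le′ (swap-injective eq)
  ... | no  _   | no  _   = proper-left le≡le′ eq
  ... | yes on  | no off  = contradiction eq (mixed-left on off le≡le′)
  ... | no  off | yes on  = contradiction (sym eq) (mixed-left on off (sym le≡le′))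

  proper-right′ : ProperAt right c′
  proper-right′ {e} {e′} re≡re′ eq with onWalk? e | onWalk? e′
  ... | yes _   | yes _   = proper-right re≡re′ (swap-injective eq)
  ... | no  _   | no  _   = proper-right re≡re′ eq
  ... | yes on  | no off  = contradiction eq (mixed-right on off re≡re′)
  ... | no  off | yes on  = contradiction (sym eq) (mixed-right on off (sym re≡re′))

  a-missing-left′ : Missing left c′ u a
  a-missing-left′ e le≡u c′e≡a with onWalk? e
  ... | no _ = a-missing e le≡u c′e≡a
  ... | yes on with swapped (onWalk-alternating on) c′e≡a
  ...   | inj₁ (_ , a≡b) = a≢b a≡b
  ...   | inj₂ (ce≡b , _) = onWalk-tail-≢-u on (trans (tail-b ce≡b) (cong inj₁ le≡u))

  a-missing-right′ : Missing right c′ w a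
  a-missing-right′ e re≡w c′e≡a with onWalk? e
  ... | no off = off (zero , next-complete (inj₁ c′e≡a) (trans (tail-a c′e≡a) (cong inj₂ re≡w)))
  ... | yes on with swapped (onWalk-alternating on) c′e≡a
  ...   | inj₁ (_ , a≡b) = a≢b a≡b
  ...   | inj₂ (ce≡b , _) = b-missing e re≡w ce≡b

proper-∷ : ∀ {A : Set} {m Δ} {end : Fin (suc m) → A} {c : Fin m → Fin Δ} {a} →
           ProperAt (end ∘ suc) c → Missing (end ∘ suc) c (end zero) a → ProperAt end (a ∷ c)
proper-∷ proper missing {zero}  {zero}   _  _  = refl
proper-∷ proper missing {zero}  {suc e′} at eq = contradiction (sym eq) (missing e′ (sym at))
proper-∷ proper missing {suc e} {zero}   at eq = contradiction eq (missing e at)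
proper-∷ proper missing {suc e} {suc e′} at eq = cong suc (proper at eq)

bipartite-edge-colouring :
  ∀ {V W : Set} (_≟ⱽ_ : DecidableEquality V) (_≟ᵂ_ : DecidableEquality W) {m} Δ
  (left : Fin m → V) (right : Fin m → W) →
  (∀ x → degreeAt _≟ⱽ_ left x ≤ Δ) → (∀ y → degreeAt _≟ᵂ_ right y ≤ Δ) →
  ∃ λ (c : Fin m → Fin Δ) → ProperAt left c × ProperAt right c
bipartite-edge-colouring _ _ {zero} Δ left right _ _ = (λ ()) , (λ { {()} }) , (λ { {()} })
bipartite-edge-colouring _≟ⱽ_ _≟ᵂ_ {suc m} Δ left right degree-left degree-right
  with bipartite-edge-colouring _≟ⱽ_ _≟ᵂ_ Δ (left ∘ suc) (right ∘ suc)
         (λ x → ≤-trans (count-∘suc (λ e → left e ≟ⱽ x)) (degree-left x))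
         (λ y → ≤-trans (count-∘suc (λ e → right e ≟ᵂ y)) (degree-right y))
... | c , proper-left , proper-right
  with missing-colour _≟ⱽ_ left (degree-left (left zero)) c
     | missing-colour _≟ᵂ_ right (degree-right (right zero)) c
... | a , a-missing | b , b-missing
  with any? (λ e → (right (suc e) ≟ᵂ right zero) ×-dec (c e ≟ a))
... | no a-unused =
  a ∷ c , proper-∷ proper-left a-missing ,
          proper-∷ proper-right λ e at ce≡a → a-unused (e , at , ce≡a)
... | yes (e₀ , at₀ , ce₀≡a) =
  a ∷ K.c′ , proper-∷ K.proper-left′ K.a-missing-left′ , proper-∷ K.proper-right′ K.a-missing-right′
  where
  module K = KempeChain _≟ⱽ_ _≟ᵂ_ (left ∘ suc) (right ∘ suc) c proper-left proper-right
                        a-missing b-missing (λ a≡b → b-missing e₀ at₀ (trans ce₀≡a a≡b))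

-- Degrees in the graphs of Defs

sum-indicator : ∀ {k} {P : Pred (Fin k) 0ℓ} (P? : Decidable P) {f : Fin k → ℕ} →
                (∀ e → P e → f e ≡ 1) → (∀ e → ¬ P e → f e ≡ 0) →
                sum (List.map f (allFin k)) ≡ count P?
sum-indicator P? {f} one none =
  trans (cong sum (List.map-tabulate (λ e → e) f)) (sum-tabulate P? one none)
  where
  sum-tabulate : ∀ {k} {P : Pred (Fin k) 0ℓ} (P? : Decidable P) {f : Fin k → ℕ} →
                 (∀ e → P e → f e ≡ 1) → (∀ e → ¬ P e → f e ≡ 0) → sum (tabulate f) ≡ count P?
  sum-tabulate {zero}  P? one none = refl
  sum-tabulate {suc k} P? one none with P? zero
  ... | yes p = cong₂ _+_ (one zero p) (sum-tabulate (P? ∘ suc) (one ∘ suc) (none ∘ suc))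
  ... | no ¬p = cong₂ _+_ (none zero ¬p) (sum-tabulate (P? ∘ suc) (one ∘ suc) (none ∘ suc))

module _ (G : Graph) where

  incident? : ∀ v → Decidable (λ e → Incident G e v)
  incident? v e = (proj₁ (ends G e) ≟ v) ⊎-dec (proj₂ (ends G e) ≟ v)

  -- Up to + 0, the summand of degree for an edge e is the degree of the one-edge graph on e,
  -- where the indicator that Defs keeps private can be evaluated.
  private
    single-edge : Fin (m G) → Graph
    single-edge e = record { n = n G ; m = 1 ; ends = λ _ → ends G e ; loopless = λ _ → loopless G e }

    incident⇒degree≡1 : ∀ e v → Incident G e v → degree (single-edge e) v ≡ 1
    incident⇒degree≡1 e v inc with proj₁ (ends G e) ≟ v | proj₂ (ends G e) ≟ v
    ... | yes p≡v | yes q≡v = contradiction (trans p≡v (sym q≡v)) (loopless G e)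
    ... | yes _   | no  _   = refl
    ... | no  _   | yes _   = refl
    ... | no  p≢v | no  q≢v = contradiction inc [ p≢v , q≢v ]

    ¬incident⇒degree≡0 : ∀ e v → ¬ Incident G e v → degree (single-edge e) v ≡ 0
    ¬incident⇒degree≡0 e v ¬inc with proj₁ (ends G e) ≟ v | proj₂ (ends G e) ≟ v
    ... | yes p≡v | _       = contradiction (inj₁ p≡v) ¬inc
    ... | no  _   | yes q≡v = contradiction (inj₂ q≡v) ¬inc
    ... | no  _   | no  _   = refl

  degree≡count : ∀ v → degree G v ≡ count (incident? v)
  degree≡count v = sum-indicator (incident? v)
    (λ e inc → trans (sym (ℕ.+-identityʳ _)) (incident⇒degree≡1 e v inc))
    (λ e ¬inc → trans (sym (ℕ.+-identityʳ _)) (¬incident⇒degree≡0 e v ¬inc))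

degree-≤-colours : ∀ (G : Graph) {t α} → IsProperColoring G t α → ∀ v → degree G v ≤ t
degree-≤-colours G {t} {α} (bounds , distinct) v = subst (_≤ t) (sym (degree≡count G v))
  (count-≤ (incident? G v) (λ e → α e ∸ 1) (λ {e} _ → below (bounds e)) injective)
  where
  below : ∀ {a} → 1 ≤ a × a ≤ t → a ∸ 1 < t
  below {suc a} (_ , a<t) = a<t

  injective : InjectiveOn (λ e → Incident G e v) (λ e → α e ∸ 1)
  injective {e} {e′} inc inc′ eq with e ≟ e′
  ... | yes e≡e′ = e≡e′
  ... | no  e≢e′ = contradiction (ℕ.∸-cancelʳ-≡ (proj₁ (bounds e)) (proj₁ (bounds e′)) eq)
                                 (distinct e e′ v e≢e′ inc inc′)

-- Balanced orientations of bipartite graphs with even degrees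

m+n≡2*k⇒m≡k : ∀ {a b k} → a + b ≡ 2 * k → a ≤ k → b ≤ k → a ≡ k
m+n≡2*k⇒m≡k {a} {b} {k} a+b≡2k a≤k b≤k with ℕ.m≤n⇒m<n∨m≡n a≤k
... | inj₂ a≡k = a≡k
... | inj₁ a<k = contradiction (trans a+b≡2k (cong (k +_) (ℕ.+-identityʳ k)))
                               (ℕ.<⇒≢ (ℕ.+-mono-<-≤ a<k b≤k))

xor-cancelˡ : ∀ x y → x xor (x xor y) ≡ y
xor-cancelˡ x y = trans (sym (Bool.xor-assoc x x y)) (cong (_xor y) (Bool.xor-same x))

xor-cancelʳ : ∀ x y → (y xor x) xor x ≡ y
xor-cancelʳ x y =
  trans (Bool.xor-comm (y xor x) x) (trans (cong (x xor_) (Bool.xor-comm y x)) (xor-cancelˡ x y))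

module Bipartite (G : Graph) (side : Fin (n G) → Bool)
  (crossing : ∀ e → side (proj₁ (ends G e)) ≢ side (proj₂ (ends G e))) where

  endpoint : Bool → Fin (m G) → Fin (n G)
  endpoint s e with side (proj₁ (ends G e)) Bool.≟ s
  ... | yes _ = proj₁ (ends G e)
  ... | no  _ = proj₂ (ends G e)

  side-endpoint : ∀ s e → side (endpoint s e) ≡ s
  side-endpoint s e with side (proj₁ (ends G e)) Bool.≟ s
  ... | yes p≡s = p≡s
  ... | no  p≢s = begin
    side (proj₂ (ends G e))       ≡⟨ Bool.¬-not (crossing e ∘ sym) ⟩
    not (side (proj₁ (ends G e))) ≡⟨ cong not (Bool.¬-not p≢s) ⟩
    not (not s)                   ≡⟨ Bool.not-involutive s ⟩
    s                             ∎
    where open ≡-Reasoning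

  endpoint-incident : ∀ s e → Incident G e (endpoint s e)
  endpoint-incident s e with side (proj₁ (ends G e)) Bool.≟ s
  ... | yes _ = inj₁ refl
  ... | no  _ = inj₂ refl

  incident⇒endpoint : ∀ {e v} → Incident G e v → endpoint (side v) e ≡ v
  incident⇒endpoint {e} {v} inc with side (proj₁ (ends G e)) Bool.≟ side v | inc
  ... | yes _       | inj₁ p≡v = p≡v
  ... | yes sp≡sv   | inj₂ q≡v = contradiction (trans sp≡sv (sym (cong side q≡v))) (crossing e)
  ... | no  sp≢sv   | inj₁ p≡v = contradiction (cong side p≡v) sp≢sv
  ... | no  _       | inj₂ q≡v = q≡v

  -- tailSide e is the side of the tail of e; role false selects the tail, role true the head.
  module Orientation (tailSide : Fin (m G) → Bool) where

    end : Bool → Fin (m G) → Fin (n G)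
    end role e = endpoint (role xor tailSide e) e

    end-role : ∀ {role e v} → end role e ≡ v → tailSide e ≡ role xor side v
    end-role {role} {e} refl = begin
      tailSide e                          ≡⟨ xor-cancelˡ role (tailSide e) ⟨
      role xor (role xor tailSide e)      ≡⟨ cong (role xor_) (side-endpoint _ e) ⟨
      role xor side (end role e)          ∎
      where open ≡-Reasoning

    incident⇒end : ∀ {e v} → Incident G e v → end (tailSide e xor side v) e ≡ v
    incident⇒end {e} {v} inc = trans
      (cong (λ s → endpoint s e) (trans (Bool.xor-comm (tailSide e xor side v) (tailSide e))
                                        (xor-cancelˡ (tailSide e) (side v))))
      (incident⇒endpoint inc)

    end-incident : ∀ {role e v} → end role e ≡ v → Incident G e v
    end-incident refl = endpoint-incident _ _

    incident⇒tail⊎head : ∀ {e v} → Incident G e v → end false e ≡ v ⊎ end true e ≡ v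
    incident⇒tail⊎head {e} {v} inc with tailSide e xor side v | incident⇒end inc
    ... | false | tail≡v = inj₁ tail≡v
    ... | true  | head≡v = inj₂ head≡v

    tail≢head : ∀ e → end false e ≢ end true e
    tail≢head e eq = Bool.not-¬ refl (begin
      tailSide e              ≡⟨ side-endpoint _ e ⟨
      side (end false e)      ≡⟨ cong side eq ⟩
      side (end true e)       ≡⟨ side-endpoint _ e ⟩
      not (tailSide e)        ∎)
      where open ≡-Reasoning

    degree-split : ∀ v →
      count (incident? G v) ≡ degreeAt _≟_ (end false) v + degreeAt _≟_ (end true) v
    degree-split v = count-⊎ (incident? G v) (λ e → end false e ≟ v) (λ e → end true e ≟ v)
      (mk⇔ incident⇒tail⊎head [ end-incident {false} , end-incident {true} ])
      (λ tail≡v head≡v → tail≢head _ (trans tail≡v (sym head≡v)))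

  true-side-vertex : Fin (n G) → (∀ v → side v ≡ false → 0 < count (incident? G v)) →
                     ∃ λ y → side y ≡ true
  true-side-vertex v₀ non-isolated with side v₀ in side-v₀
  ... | true  = v₀ , side-v₀
  ... | false = endpoint true e , side-endpoint true e
    where
    e : Fin (m G)
    e = enumerate (incident? G v₀) (fromℕ< (non-isolated v₀ side-v₀))

  IsBalanced : (Fin (n G) → ℕ) → (Fin (m G) → Bool) → Set
  IsBalanced K tailSide = ∀ role v → degreeAt _≟_ (Orientation.end tailSide role) v ≡ K v

  -- The edges at v, numbered by rank, are grouped into the pairs (v , rank / 2).  The two
  -- edges of a pair get different colours in a proper 2-edge-colouring of the pairing graph,
  -- so orienting edges by their colour lets at most half of the edges at v leave it and at
  -- most half enter it.
  private
    pairing : Bool → Fin (m G) → Fin (n G) × ℕ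
    pairing s e = endpoint s e , rank (incident? G (endpoint s e)) e / 2

    _≟ₚ_ : DecidableEquality (Fin (n G) × ℕ)
    _≟ₚ_ = Product.≡-dec _≟_ ℕ._≟_

    pairing-inv : ∀ {s e v j} → pairing s e ≡ (v , j) →
                  Incident G e v × rank (incident? G v) e / 2 ≡ j
    pairing-inv refl = endpoint-incident _ _ , refl

    pairing-degree : ∀ s x → degreeAt _≟ₚ_ (pairing s) x ≤ 2
    pairing-degree s (v , j) =
      count-≤ (λ e → pairing s e ≟ₚ (v , j)) (λ e → ρ e % 2) (λ {e} _ → m%n<n (ρ e) 2) injective
      where
      ρ : Fin (m G) → ℕ
      ρ = rank (incident? G v)

      injective : InjectiveOn (λ e → pairing s e ≡ (v , j)) (λ e → ρ e % 2)
      injective {e} {e′} at at′ eq =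
        let (inc , half) = pairing-inv at ; (inc′ , half′) = pairing-inv at′ in
        rank-injective (incident? G v) inc inc′ (begin
          ρ e                       ≡⟨ m≡m%n+[m/n]*n (ρ e) 2 ⟩
          ρ e % 2 + ρ e / 2 * 2     ≡⟨ cong₂ (λ p q → p + q * 2) eq (trans half (sym half′)) ⟩
          ρ e′ % 2 + ρ e′ / 2 * 2   ≡⟨ m≡m%n+[m/n]*n (ρ e′) 2 ⟨
          ρ e′                      ∎)
        where open ≡-Reasoning

    pairing-at : ∀ {e v} → Incident G e v → pairing (side v) e ≡ (v , rank (incident? G v) e / 2)
    pairing-at {e} {v} inc with endpoint (side v) e | incident⇒endpoint inc
    ... | _ | refl = refl

  balanced-orientation : (K : Fin (n G) → ℕ) → (∀ v → count (incident? G v) ≡ 2 * K v) →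
                         ∃ (IsBalanced K)
  balanced-orientation K even = tailSide , balanced
    where
    colouring : ∃ λ (c : Fin (m G) → Fin 2) → ProperAt (pairing false) c × ProperAt (pairing true) c
    colouring = bipartite-edge-colouring _≟ₚ_ _≟ₚ_ 2 (pairing false) (pairing true)
                                         (pairing-degree false) (pairing-degree true)
    h : Fin (m G) → Fin 2
    h = proj₁ colouring

    proper : ∀ s → ProperAt (pairing s) h
    proper false = proj₁ (proj₂ colouring)
    proper true  = proj₂ (proj₂ colouring)

    tailSide : Fin (m G) → Bool
    tailSide e = Inverse.to 2↔Bool (h e)

    tailSide-injective : ∀ {e e′} → tailSide e ≡ tailSide e′ → h e ≡ h e′
    tailSide-injective {e} {e′} eq = begin
      h e                                    ≡⟨ Inverse.strictlyInverseʳ 2↔Bool (h e) ⟨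
      Inverse.from 2↔Bool (tailSide e)       ≡⟨ cong (Inverse.from 2↔Bool) eq ⟩
      Inverse.from 2↔Bool (tailSide e′)      ≡⟨ Inverse.strictlyInverseʳ 2↔Bool (h e′) ⟩
      h e′                                   ∎
      where open ≡-Reasoning

    open Orientation tailSide

    at-most-K : ∀ role v → degreeAt _≟_ (end role) v ≤ K v
    at-most-K role v = count-≤ (λ e → end role e ≟ v) (λ e → rank (incident? G v) e / 2)
      (λ {e} at → m<n*o⇒m/o<n (subst (rank (incident? G v) e <_) (trans (even v) (ℕ.*-comm 2 (K v)))
                                     (rank-< (incident? G v) (end-incident {role} at))))
      λ {e} {e′} at at′ half≡half′ → proper (side v)
        (trans (pairing-at (end-incident {role} at))
               (trans (cong (v ,_) half≡half′) (sym (pairing-at (end-incident {role} at′)))))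
        (tailSide-injective (trans (end-role {role} at) (sym (end-role {role} at′))))

    balanced : IsBalanced K tailSide
    balanced false v = m+n≡2*k⇒m≡k (trans (sym (degree-split v)) (even v))
                                   (at-most-K false v) (at-most-K true v)
    balanced true  v = m+n≡2*k⇒m≡k (trans (ℕ.+-comm (degreeAt _≟_ (end true) v) _)
                                          (trans (sym (degree-split v)) (even v)))
                                   (at-most-K true v) (at-most-K false v)

-- The cyclic interval colouring

interval-consecutive : ∀ {P : ℕ → Set} {lo hi} → (∀ x → P x → lo ≤ x × x ≤ hi) →
                       (∀ x → lo ≤ x → x ≤ hi → P x) → Consecutive P
interval-consecutive within full x y z px pz x≤y y≤z =
  full y (≤-trans (proj₁ (within x px)) x≤y) (≤-trans y≤z (proj₂ (within z pz)))

⊆-pair-consecutive : ∀ {P : ℕ → Set} {k} → (∀ x → P x → k ≤ x × x ≤ suc k) → Consecutive P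
⊆-pair-consecutive {P} within x y z px pz x≤y y≤z with ℕ.m≤n⇒m<n∨m≡n x≤y
... | inj₂ refl = px
... | inj₁ x<y  = subst P (ℕ.≤-antisym z≤y y≤z) pz
  where
  z≤y : z ≤ y
  z≤y = ≤-trans (proj₂ (within z pz)) (≤-trans (s≤s (proj₁ (within x px))) x<y)

module SplitColouring (G : Graph) (side : Fin (n G) → Bool)
  (crossing : ∀ e → side (proj₁ (ends G e)) ≢ side (proj₂ (ends G e)))
  (r′ : ℕ) (tailSide : Fin (m G) → Bool)
  (balanced : Bipartite.IsBalanced G side crossing (λ v → if side v then suc r′ else r′) tailSide)
  where

  open Bipartite G side crossing
  open Orientation tailSide

  r : ℕ
  r = suc r′

  SplitVertex : Set
  SplitVertex = Fin (n G) ⊎ Fin (n G)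

  _≟ˢ_ : DecidableEquality SplitVertex
  _≟ˢ_ = Sum.≡-dec _≟_ _≟_

  -- inj₁ v is the out-copy (role false) resp. in-copy (role true) of v.  The dummy edge of a
  -- false-side vertex joins its two copies; that of a true-side vertex is parked at the
  -- otherwise unused vertex inj₂ v.
  dummy : Fin (n G) → SplitVertex
  dummy v = if side v then inj₂ v else inj₁ v

  split : Bool → Fin (m G + n G) → SplitVertex
  split role = [ inj₁ ∘ end role , dummy ]′ ∘ Fin.splitAt (m G)

  split-↑ˡ : ∀ role e → split role (e ↑ˡ n G) ≡ inj₁ (end role e)
  split-↑ˡ role e = cong [ inj₁ ∘ end role , dummy ]′ (Fin.splitAt-↑ˡ (m G) e (n G))

  split-↑ʳ : ∀ role v → split role (m G ↑ʳ v) ≡ dummy v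
  split-↑ʳ role v = cong [ inj₁ ∘ end role , dummy ]′ (Fin.splitAt-↑ʳ (m G) (n G) v)

  dummy-inj₁ : ∀ {v′ v} → dummy v′ ≡ inj₁ v → v′ ≡ v × side v ≡ false
  dummy-inj₁ {v′} eq with side v′ in side-v′
  dummy-inj₁ {v′} () | true
  dummy-inj₁ {v′} refl | false = refl , side-v′

  dummy-inj₂ : ∀ {v′ v} → dummy v′ ≡ inj₂ v → v′ ≡ v
  dummy-inj₂ {v′} eq with side v′
  dummy-inj₂ {v′} refl | true = refl
  dummy-inj₂ {v′} ()   | false

  split-inj₁ : ∀ {role e v} → split role e ≡ inj₁ v →
               (∃ λ e′ → e ≡ e′ ↑ˡ n G × end role e′ ≡ v) ⊎ (e ≡ m G ↑ʳ v × side v ≡ false)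
  split-inj₁ {role} {e} eq with Fin.splitAt (m G) e in splitAt-e
  ... | inj₁ e′ = inj₁ (e′ , sym (Fin.splitAt⁻¹-↑ˡ splitAt-e) , Sum.inj₁-injective eq)
  ... | inj₂ v′ = let (v′≡v , side-v) = dummy-inj₁ eq in
    inj₂ (trans (sym (Fin.splitAt⁻¹-↑ʳ splitAt-e)) (cong (m G ↑ʳ_) v′≡v) , side-v)

  split-inj₂ : ∀ {role e v} → split role e ≡ inj₂ v → e ≡ m G ↑ʳ v
  split-inj₂ {role} {e} eq with Fin.splitAt (m G) e in splitAt-e
  ... | inj₂ v′ = trans (sym (Fin.splitAt⁻¹-↑ʳ splitAt-e)) (cong (m G ↑ʳ_) (dummy-inj₂ eq))

  private
    dummy-at : ∀ {role v′ v} → split role (m G ↑ʳ v′) ≡ inj₁ v → v′ ≡ v × side v ≡ false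
    dummy-at {role} {v′} at = dummy-inj₁ (trans (sym (split-↑ʳ role v′)) at)

    dummy-false : ∀ {v} → side v ≡ false → dummy v ≡ inj₁ v
    dummy-false side-v rewrite side-v = refl

    real-degree : ∀ role v →
      count (λ e → split role (e ↑ˡ n G) ≟ˢ inj₁ v) ≡ (if side v then r else r′)
    real-degree role v = trans
      (count-≡ _ _ λ {e} → mk⇔ (λ eq → Sum.inj₁-injective (trans (sym (split-↑ˡ role e)) eq))
                               (λ eq → trans (split-↑ˡ role e) (cong inj₁ eq)))
      (balanced role v)

    dummy-unique : ∀ {role v} → InjectiveOn (λ v′ → split role (m G ↑ʳ v′) ≡ inj₁ v) (λ _ → 0)
    dummy-unique {role} at at′ _ = trans (proj₁ (dummy-at {role} at)) (sym (proj₁ (dummy-at {role} at′)))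

    dummy-degree : ∀ role v →
      count (λ v′ → split role (m G ↑ʳ v′) ≟ˢ inj₁ v) ≡ (if side v then 0 else 1)
    dummy-degree role v with side v in side-v
    ... | true  = ℕ.n≤0⇒n≡0 (count-≤ _ (λ _ → 0)
                    (λ at → contradiction (trans (sym side-v) (proj₂ (dummy-at {role} at))) λ ())
                    (dummy-unique {role}))
    ... | false = ℕ.≤-antisym
                    (count-≤ _ (λ _ → 0) (λ _ → s≤s z≤n) (dummy-unique {role}))
                    (count-≥ _ (λ _ → v) (λ { {zero} {zero} _ → refl })
                      (λ _ → trans (split-↑ʳ role v) (dummy-false side-v)))

  split-degree-inj₁ : ∀ role v → degreeAt _≟ˢ_ (split role) (inj₁ v) ≡ r
  split-degree-inj₁ role v = begin
    degreeAt _≟ˢ_ (split role) (inj₁ v)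
      ≡⟨ count-↑ {m G} {n G} (λ e → split role e ≟ˢ inj₁ v) ⟩
    count (λ e → split role (e ↑ˡ n G) ≟ˢ inj₁ v) + count (λ v′ → split role (m G ↑ʳ v′) ≟ˢ inj₁ v)
      ≡⟨ cong₂ _+_ (real-degree role v) (dummy-degree role v) ⟩
    (if side v then r else r′) + (if side v then 0 else 1)
      ≡⟨ real+dummy≡r (side v) ⟩
    r ∎
    where
    open ≡-Reasoning
    real+dummy≡r : ∀ s → (if s then r else r′) + (if s then 0 else 1) ≡ r
    real+dummy≡r true  = ℕ.+-identityʳ r
    real+dummy≡r false = ℕ.+-comm r′ 1

  split-degree : ∀ role x → degreeAt _≟ˢ_ (split role) x ≤ r
  split-degree role (inj₁ v) = ℕ.≤-reflexive (split-degree-inj₁ role v)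
  split-degree role (inj₂ v) = ≤-trans
    (count-≤ (λ e → split role e ≟ˢ inj₂ v) (λ _ → 0) (λ _ → s≤s z≤n)
             (λ at at′ _ → trans (split-inj₂ {role} at) (sym (split-inj₂ {role} at′))))
    (s≤s z≤n)

  -- Opaque, so that unification never unfolds the Kőnig construction.
  opaque
    split-colouring : ∃ λ (c : Fin (m G + n G) → Fin r) →
                        ProperAt (split false) c × ProperAt (split true) c
    split-colouring = bipartite-edge-colouring _≟ˢ_ _≟ˢ_ r (split false) (split true)
                                               (split-degree false) (split-degree true)

  splitColour : Fin (m G + n G) → Fin r
  splitColour = proj₁ split-colouring

  split-proper : ∀ role → ProperAt (split role) splitColour
  split-proper false = proj₁ (proj₂ split-colouring)
  split-proper true  = proj₂ (proj₂ split-colouring)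

  every-colour-at : ∀ role v i → ∃ λ e → split role e ≡ inj₁ v × splitColour e ≡ i
  every-colour-at role v i =
    let (e , at , eq) = count-covers (λ e → split role e ≟ˢ inj₁ v) (toℕ ∘ splitColour)
          (λ _ → Fin.toℕ<n _)
          (λ at at′ eq → split-proper role (trans at (sym at′)) (Fin.toℕ-injective eq))
          (ℕ.≤-reflexive (sym (split-degree-inj₁ role v))) (Fin.toℕ<n i)
    in e , at , Fin.toℕ-injective eq

  bit : Bool → Fin 2
  bit = Inverse.from 2↔Bool

  bit-injective : ∀ {b b′} → bit b ≡ bit b′ → b ≡ b′
  bit-injective {b} {b′} eq = begin
    b                           ≡⟨ Inverse.strictlyInverseˡ 2↔Bool b ⟨
    Inverse.to 2↔Bool (bit b)   ≡⟨ cong (Inverse.to 2↔Bool) eq ⟩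
    Inverse.to 2↔Bool (bit b′)  ≡⟨ Inverse.strictlyInverseˡ 2↔Bool b′ ⟩
    b′                          ∎
    where open ≡-Reasoning

  -- Since toℕ (combine i j) = 2 i + j, the edge e gets colour 2 i + 1 or 2 i + 2, where i is
  -- its colour in the split graph, according as its tail lies on the false or the true side.
  colourCode : Fin (m G) → Fin (r * 2)
  colourCode e = Fin.combine (splitColour (e ↑ˡ n G)) (bit (tailSide e))

  colour : Fin (m G) → ℕ
  colour e = suc (toℕ (colourCode e))

  colour-bounds : ∀ e → 1 ≤ colour e × colour e ≤ 2 * r
  colour-bounds e = s≤s z≤n , subst (colour e ≤_) (ℕ.*-comm r 2) (Fin.toℕ<n (colourCode e))

  incident⇒split : ∀ {e v} → Incident G e v → split (tailSide e xor side v) (e ↑ˡ n G) ≡ inj₁ v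
  incident⇒split {e} {v} inc =
    trans (split-↑ˡ (tailSide e xor side v) e) (cong inj₁ (incident⇒end inc))

  colour-proper : IsProperColoring G (2 * r) colour
  colour-proper = colour-bounds , λ e e′ v e≢e′ inc inc′ eq →
    let (same-split , same-bit) =
          Fin.combine-injective _ _ _ _ (Fin.toℕ-injective (ℕ.suc-injective eq))
        at′ = subst (λ t → split (t xor side v) (e′ ↑ˡ n G) ≡ inj₁ v)
                    (sym (bit-injective same-bit)) (incident⇒split inc′)
    in e≢e′ (Fin.↑ˡ-injective (n G) e e′
         (split-proper (tailSide e xor side v) (trans (incident⇒split inc) (sym at′)) same-split))

  colour-decode : ∀ {c} → 1 ≤ c → c ≤ 2 * r →
                  ∃ λ (i : Fin r) → ∃ λ (b : Bool) → c ≡ suc (toℕ (Fin.combine i (bit b)))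
  colour-decode {suc k} _ c≤2r
    with Fin.combine-surjective {r} {2} (fromℕ< (subst (suc k ≤_) (ℕ.*-comm 2 r) c≤2r))
  ... | i , j , eq = i , Inverse.to 2↔Bool j , cong suc (begin
    k                                                ≡⟨ Fin.toℕ-fromℕ< _ ⟨
    toℕ (fromℕ< _)                                   ≡⟨ cong toℕ eq ⟨
    toℕ (Fin.combine i j)                            ≡⟨ cong (toℕ ∘ Fin.combine i)
                                                             (Inverse.strictlyInverseʳ 2↔Bool j) ⟨
    toℕ (Fin.combine i (bit (Inverse.to 2↔Bool j)))  ∎)
    where open ≡-Reasoning

  colour-realised : ∀ {v} i b → (side v ≡ false → i ≢ splitColour (m G ↑ʳ v)) →
                    InS G colour v (suc (toℕ (Fin.combine i (bit b))))
  colour-realised {v} i b not-dummy with every-colour-at (b xor side v) v i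
  ... | e* , at , ce*≡i with split-inj₁ {b xor side v} at
  ...   | inj₂ (e*≡dummy , side-v) =
    contradiction (trans (sym ce*≡i) (cong splitColour e*≡dummy)) (not-dummy side-v)
  ...   | inj₁ (e , refl , end≡v) = e , end-incident {b xor side v} end≡v ,
    cong₂ (λ i′ b′ → suc (toℕ (Fin.combine i′ (bit b′)))) ce*≡i
          (trans (end-role {b xor side v} end≡v) (xor-cancelʳ (side v) b))

  colours-at-true-side : ∀ {v} → side v ≡ true → ∀ c → 1 ≤ c → c ≤ 2 * r → InS G colour v c
  colours-at-true-side side-v c 1≤c c≤2r with colour-decode 1≤c c≤2r
  ... | i , b , refl = colour-realised i b λ side-v′ → contradiction (trans (sym side-v) side-v′) λ ()

  missing-at-false-side : ∀ {v} → side v ≡ false → ∀ c → InCoS G (2 * r) colour v c →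
    let k = suc (2 * toℕ (splitColour (m G ↑ʳ v))) in k ≤ c × c ≤ suc k
  missing-at-false-side {v} side-v c ((1≤c , c≤2r) , absent) with colour-decode 1≤c c≤2r
  ... | i , b , refl with i ≟ splitColour (m G ↑ʳ v)
  ...   | no  i≢i₀ = contradiction (colour-realised i b λ _ → i≢i₀) absent
  ...   | yes refl rewrite Fin.toℕ-combine i (bit b) =
    s≤s (ℕ.m≤m+n _ _) ,
    s≤s (≤-trans (ℕ.+-monoʳ-≤ (2 * toℕ i) (ℕ.s≤s⁻¹ (Fin.toℕ<n (bit b))))
                 (ℕ.≤-reflexive (ℕ.+-comm _ 1)))

  colour-cyclic : IsCyclicIntervalColoring G (2 * r) colour
  colour-cyclic = colour-proper , λ v → at-vertex v (side v) refl
    where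
    at-vertex : ∀ v s → side v ≡ s →
                Consecutive (InS G colour v) ⊎ Consecutive (InCoS G (2 * r) colour v)
    at-vertex v true  side-v = inj₁ (interval-consecutive (λ { _ (e , _ , refl) → colour-bounds e })
                                                         (colours-at-true-side side-v))
    at-vertex v false side-v = inj₂ (⊆-pair-consecutive (missing-at-false-side side-v))

corollary5 : (r : ℕ) → 2 ≤ r → (G : Graph) → NonZero (n G) →
    Biregular (2 * r ∸ 2) (2 * r) G →
    CyclicallyIntervalColorable G × WcIs G (2 * r)
corollary5 r@(suc r′@(suc _)) (s≤s (s≤s z≤n)) G nonzero (side , crossing , degree-false , degree-true) =
  (2 * r , 1≤2r , colouring) , (1≤2r , colouring) ,
  λ t _ (α , proper , _) → let (y , side-y) = y-vertex in
    subst (_≤ t) (degree-true y side-y) (degree-≤-colours G proper y)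
  where
  open Bipartite G side crossing

  1≤2r : 1 ≤ 2 * r
  1≤2r = s≤s z≤n

  false-side-count : ∀ {v} → side v ≡ false → count (incident? G v) ≡ 2 * r′
  false-side-count {v} side-v = trans (sym (degree≡count G v))
    (trans (degree-false v side-v) (sym (ℕ.*-distribˡ-∸ 2 r 1)))

  even : ∀ v → count (incident? G v) ≡ 2 * (if side v then r else r′)
  even v with side v in side-v
  ... | true  = trans (sym (degree≡count G v)) (degree-true v side-v)
  ... | false = false-side-count side-v

  orientation : ∃ (IsBalanced (λ v → if side v then r else r′))
  orientation = balanced-orientation _ even

  open SplitColouring G side crossing r′ (proj₁ orientation) (proj₂ orientation)
    using (colour; colour-cyclic)

  colouring : HasCyclicIntervalColoring G (2 * r)
  colouring = colour , colour-cyclic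

  y-vertex : ∃ λ y → side y ≡ true
  y-vertex = true-side-vertex (fromℕ< (ℕ.>-nonZero⁻¹ (n G) {{nonzero}}))
                              (λ v side-v → subst (0 <_) (sym (false-side-count side-v)) (s≤s z≤n))
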